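{- Let $G$ be a bridgeless cubic graph containing two disjoint matchings $A_1$ and $A_2$ such that $\overline{G_{A_1}}$ is $3$-edge colourable and $A_1\cup A_2$ forms a union of vertex-disjoint cycles. Then $G$ has an FR-triple $\mathcal T$ with $T_2=A_1$ and $T_0=A_2$.
   Context: An FR-triple of $G$ is an ordered triple $(M_1,M_2,M_3)$ of perfect matchings of $G$ with $M_1\cap M_2\cap M_3=\emptyset$; $T_i$ ($i=0,1,2$) is the set of edges contained in exactly $i$ of $M_1,M_2,M_3$. Splitting: let $A_1,A_2$ be disjoint matchings of the cubic graph $G$ such that $A_1\cup A_2$ is a union of vertex-disjoint cycles (these cycles alternate between $A_1$ and $A_2$, so every endpoint of an edge of $A_1$ is incident with exactly one edge of $A_2$ and one further edge, called its third edge). For $\{i,j\}=\{1,2\}$, $G_{A_i}$ is obtained from $G$ by, for every edge $ab\in A_i$, replacing $a$ by two new vertices $a'$ (incident with the third edge formerly at $a$) and $a''$ (incident with the $A_j$-edge formerly at $a$), replacing $b$ likewise by $b',b''$, and replacing the edge $ab$ by the two edges $a'b'$ and $a''b''$. The resulting graph has vertices of degrees $3$ and $2$. $\overline{G_{A_i}}$ is obtained from $G_{A_i}$ by suppressing degree-$2$ vertices: each maximal path whose internal vertices have degree $2$ becomes a single edge, and each cycle all of whose vertices have degree $2$ becomes a vertexless loop (one edge, no vertex). The components of $\overline{G_{A_i}}$ are cubic (multi)graphs and vertexless loops; $\overline{G_{A_i}}$ is called $3$-edge colourable if each of its cubic components is $3$-edge colourable. -}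

module Defs where

open import Data.Fin using (Fin; zero; suc)
open import Data.Nat using (ℕ; _+_)
open import Data.Bool using (Bool; true; false; _∨_)
open import Data.Bool.Properties using (∨-zeroʳ)
open import Data.Product using (Σ; ∃; _×_; _,_; proj₁; proj₂)
open import Data.Sum using (_⊎_; inj₁; inj₂)
open import Data.Unit using (⊤)
open import Relation.Binary.PropositionalEquality using (_≡_; refl; _≢_; cong; trans)
open import Relation.Nullary using (¬_)
open import Function.Definitions using (Injective)

-- Parallel edges and loops are allowed by
-- the type; a loop is an edge e with end e 0 ≡ end e 1.

record Graph : Set₁ where
  constructor mkGraph
  field
    V   : Set
    E   : Set
    end : E → Fin 2 → V

FinGraph : (n m : ℕ) → (Fin m → Fin 2 → Fin n) → Graph
FinGraph n m end = mkGraph (Fin n) (Fin m) end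

opp : Fin 2 → Fin 2
opp zero = suc zero
opp (suc _) = zero

module _ (G : Graph) where
  open Graph G

  -- darts = edge-ends (a loop contributes two darts at its vertex)
  Dart : Set
  Dart = E × Fin 2

  vtx : Dart → V
  vtx (e , i) = end e i

  EdgeSet : Set
  EdgeSet = E → Bool

  In : EdgeSet → E → Set
  In S e = S e ≡ true

  DegreeIn : (E → Set) → ℕ → V → Set
  DegreeIn P k v =
    Σ (Fin k → Dart) λ f →
      Injective _≡_ _≡_ f
      × (∀ i → vtx (f i) ≡ v × P (proj₁ (f i)))
      × (∀ d → vtx d ≡ v → P (proj₁ d) → ∃ λ i → f i ≡ d)

  Degree : ℕ → V → Set
  Degree k v = DegreeIn (λ _ → ⊤) k v

  Cubic : Set
  Cubic = ∀ v → Degree 3 v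

  data ReachAvoid (e : E) (u : V) : V → Set where
    here : ReachAvoid e u u
    step : ∀ f i → f ≢ e → ReachAvoid e u (end f i) → ReachAvoid e u (end f (opp i))

  Bridgeless : Set
  Bridgeless = ∀ e → ReachAvoid e (end e zero) (end e (suc zero))

  IsMatching : EdgeSet → Set
  IsMatching M = ∀ d d' → vtx d ≡ vtx d' → In M (proj₁ d) → In M (proj₁ d') → d ≡ d'

  IsPerfectMatching : EdgeSet → Set
  IsPerfectMatching M = IsMatching M × (∀ v → ∃ λ d → vtx d ≡ v × In M (proj₁ d))

  Disjoint : EdgeSet → EdgeSet → Set
  Disjoint A B = ∀ e → ¬ (In A e × In B e)

  -- the edge set A ∪ B is a union of vertex-disjoint cycles:
  -- every vertex has degree 0 or 2 in the subgraph formed by A ∪ B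
  UnionOfDisjointCycles : EdgeSet → EdgeSet → Set
  UnionOfDisjointCycles A B =
    ∀ v → DegreeIn P 0 v ⊎ DegreeIn P 2 v
    where
    P : E → Set
    P e = In A e ⊎ In B e

  b2n : Bool → ℕ
  b2n true = 1
  b2n false = 0

  mult : EdgeSet → EdgeSet → EdgeSet → E → ℕ
  mult M₁ M₂ M₃ e = b2n (M₁ e) + b2n (M₂ e) + b2n (M₃ e)

  IsFRTriple : EdgeSet → EdgeSet → EdgeSet → Set
  IsFRTriple M₁ M₂ M₃ =
    IsPerfectMatching M₁ × IsPerfectMatching M₂ × IsPerfectMatching M₃
    × (∀ e → ¬ (In M₁ e × In M₂ e × In M₃ e))

  Tset : EdgeSet → EdgeSet → EdgeSet → ℕ → E → Set
  Tset M₁ M₂ M₃ k e = mult M₁ M₂ M₃ e ≡ k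

  SameSet : (E → Set) → EdgeSet → Set
  SameSet P A = ∀ e → (P e → In A e) × (In A e → P e)

  -- The splitting G_A (A = A_i the matching that is split, B = A_j).
  -- Vertex (v , 0) is v itself if v is not covered, and v' otherwise;
  -- vertex (v , 1) is v'' (only present when v is covered by A ∪ B).
  -- Edge (f , 0) is f if f ∉ A, and a'b' if f = ab ∈ A;
  -- edge (f , 1) is a''b'' (only present when f ∈ A).

  Covered : EdgeSet → EdgeSet → V → Set
  Covered A B v = ∃ λ d → vtx d ≡ v × In (λ e → A e ∨ B e) (proj₁ d)

  record SplitV (A B : EdgeSet) : Set where
    constructor sv
    field
      base     : V
      copy     : Fin 2
      .present : copy ≡ zero ⊎ Covered A B base

  record SplitE (A : EdgeSet) : Set where
    constructor se
    field
      base     : E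
      copy     : Fin 2
      .present : copy ≡ zero ⊎ In A base

  splitEnd : (A B : EdgeSet) → SplitE A → Fin 2 → SplitV A B
  splitEnd A B (se f k _) i with A f in eqA
  ... | true = sv (end f i) k (ok k)
    where
    ok : (k : Fin 2) → k ≡ zero ⊎ Covered A B (end f i)
    ok zero = inj₁ refl
    ok (suc _) = inj₂ ((f , i) , refl , cong (_∨ B f) eqA)
  ... | false with B f in eqB
  ...   | true  = sv (end f i) (suc zero) (inj₂ ((f , i) , refl , trans (cong (A f ∨_) eqB) (∨-zeroʳ (A f))))
  ...   | false = sv (end f i) zero (inj₁ refl)

  Split : EdgeSet → EdgeSet → Graph
  Split A B = mkGraph (SplitV A B) (SplitE A) (splitEnd A B)

-- H (all of whose vertices have degree 2 or 3) has a 3-edge-colourable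
-- suppression \overline{H}: every edge of \overline{H} (incl. vertexless
-- loops) is a maximal thread of H through degree-2 vertices, so a colouring
-- of \overline{H}'s cubic components is a colouring of the edges of H that
-- is constant through every degree-2 vertex and proper (the three darts get
-- distinct colours) at every degree-3 vertex.

SuppressedColourable3 : Graph → Set
SuppressedColourable3 H =
  ∃ λ (c : Graph.E H → Fin 3) →
    ∀ v (d d' : Dart H) → vtx H d ≡ v → vtx H d' ≡ v → d ≢ d' →
      (Degree H 2 v → c (proj₁ d) ≡ c (proj₁ d'))
      × (Degree H 3 v → c (proj₁ d) ≢ c (proj₁ d'))

{-# OPTIONS --safe #-}
module Submission where

-- Colour every edge of G by the colour of its copy in G_{A₁} (for ab ∈ A₁ the
-- copy a′b′).  A vertex off the cycles of A₁ ∪ A₂ keeps degree 3 in the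
-- splitting, so its three edges get distinct colours; a vertex v on a cycle
-- becomes v′ of degree 2, carrying its A₁-edge and its third edge, which
-- therefore get the same colour.  Hence for every colour k the edge set
--   M_k = {e ∈ A₁ : c e ≠ k} ∪ {e ∉ A₁ ∪ A₂ : c e = k}
-- meets every vertex exactly once.  An edge of A₁ lies in two of the M_k, an
-- edge of A₂ in none and every other edge in exactly one.

open import Defs
open import Data.Bool using (Bool; true; false; not)
open import Data.Bool.Properties using (¬-not; not-¬)
open import Data.Empty using (⊥-elim-irr)
open import Data.Fin using (Fin; zero; suc; _≟_)
open import Data.Fin.Properties using (punchOut-injective; ¬Fin0)
open import Data.Nat using (ℕ; _+_)
open import Data.Product using (∃; ∃₂; _×_; _,_; proj₁; proj₂)
open import Data.Sum using (_⊎_; inj₁; inj₂; [_,_]′; map)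
open import Data.Unit using (⊤; tt)
open import Function using (_∘_; _∋_)
open import Function.Bundles using (_⇔_; mk⇔; Equivalence)
open import Function.Definitions using (Injective)
open import Function.Properties.Equivalence using () renaming (sym to ⇔-sym)
open import Relation.Binary.PropositionalEquality using (_≡_; _≢_; refl; sym; trans; cong)
open import Relation.Nullary using (¬_; Dec; yes; no; does; contradiction)

unique-other₂ : {y z w : Fin 2} → z ≢ y → w ≢ y → z ≡ w
unique-other₂ {zero}     {suc zero} {suc zero} _   _   = refl
unique-other₂ {suc zero} {zero}     {zero}     _   _   = refl
unique-other₂ {zero}     {zero}                z≢y _   = contradiction refl z≢y
unique-other₂ {suc zero} {suc zero}            z≢y _   = contradiction refl z≢y
unique-other₂ {zero}     {suc zero} {zero}     _   w≢y = contradiction refl w≢y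
unique-other₂ {suc zero} {zero}     {suc zero} _   w≢y = contradiction refl w≢y

unique-other₃ : {x y z w : Fin 3} → x ≢ y → z ≢ x → z ≢ y → w ≢ x → w ≢ y → z ≡ w
unique-other₃ x≢y z≢x z≢y w≢x w≢y =
  punchOut-injective (z≢x ∘ sym) (w≢x ∘ sym) (unique-other₂
    (z≢y ∘ punchOut-injective (z≢x ∘ sym) x≢y)
    (w≢y ∘ punchOut-injective (w≢x ∘ sym) x≢y))

other₃ : (x y : Fin 3) → x ≢ y → ∃ λ z → z ≢ x × z ≢ y
other₃ zero             zero             x≢y = contradiction refl x≢y
other₃ zero             (suc zero)       _   = suc (suc zero) , (λ ()) , (λ ())
other₃ zero             (suc (suc zero)) _   = suc zero , (λ ()) , (λ ())
other₃ (suc zero)       zero             _   = suc (suc zero) , (λ ()) , (λ ())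
other₃ (suc zero)       (suc zero)       x≢y = contradiction refl x≢y
other₃ (suc zero)       (suc (suc zero)) _   = zero , (λ ()) , (λ ())
other₃ (suc (suc zero)) zero             _   = suc zero , (λ ()) , (λ ())
other₃ (suc (suc zero)) (suc zero)       _   = zero , (λ ()) , (λ ())
other₃ (suc (suc zero)) (suc (suc zero)) x≢y = contradiction refl x≢y

cover₃ : {x y z : Fin 3} → x ≢ y → x ≢ z → y ≢ z → ∀ k → k ≡ x ⊎ k ≡ y ⊎ k ≡ z
cover₃ {x} {y} x≢y x≢z y≢z k with k ≟ x | k ≟ y
... | yes k≡x | _       = inj₁ k≡x
... | no _    | yes k≡y = inj₂ (inj₁ k≡y)
... | no k≢x  | no k≢y  = inj₂ (inj₂ (unique-other₃ x≢y k≢x k≢y (x≢z ∘ sym) (y≢z ∘ sym)))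

does≡true⇔ : ∀ {P : Set} (P? : Dec P) → does P? ≡ true ⇔ P
does≡true⇔ (yes p) = mk⇔ (λ _ → p) (λ _ → refl)
does≡true⇔ (no ¬p) = mk⇔ (λ ()) (λ p → contradiction p ¬p)

not-does≡true⇔ : ∀ {P : Set} (P? : Dec P) → not (does P?) ≡ true ⇔ (¬ P)
not-does≡true⇔ (yes p) = mk⇔ (λ ()) (λ ¬p → contradiction p ¬p)
not-does≡true⇔ (no ¬p) = mk⇔ (λ _ → ¬p) (λ _ → refl)

module _ (G : Graph) where
  open Graph G

  UniqueDart : (E → Set) → V → Set
  UniqueDart P v =
    ∃ λ d → vtx G d ≡ v × P (proj₁ d) × (∀ d′ → vtx G d′ ≡ v → P (proj₁ d′) → d′ ≡ d)

  UniqueDart-resp : ∀ {P Q : E → Set} {v} →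
    (∀ d → vtx G d ≡ v → P (proj₁ d) ⇔ Q (proj₁ d)) → UniqueDart P v → UniqueDart Q v
  UniqueDart-resp P⇔Q (d , d-at , Pd , only) =
    d , d-at , Equivalence.to (P⇔Q d d-at) Pd ,
    λ d′ d′-at Qd′ → only d′ d′-at (Equivalence.from (P⇔Q d′ d′-at) Qd′)

  unique⇒perfectMatching : ∀ {M} → (∀ v → UniqueDart (In G M) v) → IsPerfectMatching G M
  unique⇒perfectMatching {M} unique = matching , covering
    where
    matching : IsMatching G M
    matching d d′ same d∈M d′∈M with _ , _ , _ , only ← unique (vtx G d) =
      trans (only d refl d∈M) (sym (only d′ (sym same) d′∈M))
    covering : ∀ v → ∃ λ d → vtx G d ≡ v × In G M (proj₁ d)
    covering v with d , d-at , d∈M , _ ← unique v = d , d-at , d∈M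

  Degree⇒DegreeIn : ∀ {P : E → Set} {k v} →
    (∀ d → vtx G d ≡ v → P (proj₁ d)) → Degree G k v → DegreeIn G P k v
  Degree⇒DegreeIn all-P (f , f-inj , f-at , f-all) =
    f , f-inj , (λ i → proj₁ (f-at i) , all-P (f i) (proj₁ (f-at i))) , (λ d d-at _ → f-all d d-at tt)

  pair⇒DegreeIn₂ : ∀ {P : E → Set} {v x y} → x ≢ y →
    vtx G x ≡ v → vtx G y ≡ v → P (proj₁ x) → P (proj₁ y) →
    (∀ d → vtx G d ≡ v → P (proj₁ d) → d ≡ x ⊎ d ≡ y) → DegreeIn G P 2 v
  pair⇒DegreeIn₂ {P} {v} {x} {y} x≢y x-at y-at Px Py only = pair , pair-injective , pair-at , pair-all
    where
    pair : Fin 2 → Dart G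
    pair zero       = x
    pair (suc zero) = y
    pair-injective : Injective _≡_ _≡_ pair
    pair-injective {zero}     {zero}     _   = refl
    pair-injective {zero}     {suc zero} x≡y = contradiction x≡y x≢y
    pair-injective {suc zero} {zero}     y≡x = contradiction (sym y≡x) x≢y
    pair-injective {suc zero} {suc zero} _   = refl
    pair-at : ∀ i → vtx G (pair i) ≡ v × P (proj₁ (pair i))
    pair-at zero       = x-at , Px
    pair-at (suc zero) = y-at , Py
    pair-all : ∀ d → vtx G d ≡ v → P (proj₁ d) → ∃ λ i → pair i ≡ d
    pair-all d d-at Pd = [ (λ d≡x → zero , sym d≡x) , (λ d≡y → suc zero , sym d≡y) ]′ (only d d-at Pd)

  third-dart : ∀ {v x y} → Degree G 3 v → vtx G x ≡ v → vtx G y ≡ v → x ≢ y →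
    ∃ λ z → vtx G z ≡ v × z ≢ x × z ≢ y
  third-dart (f , f-inj , f-at , f-all) x-at y-at x≢y
    with i , refl ← f-all _ x-at tt | j , refl ← f-all _ y-at tt
    with l , l≢i , l≢j ← other₃ i j (x≢y ∘ cong f)
    = f l , proj₁ (f-at l) , l≢i ∘ f-inj , l≢j ∘ f-inj

  darts⊆three : ∀ {v x y z} → Degree G 3 v → vtx G x ≡ v → vtx G y ≡ v → vtx G z ≡ v →
    x ≢ y → x ≢ z → y ≢ z → ∀ d → vtx G d ≡ v → d ≡ x ⊎ d ≡ y ⊎ d ≡ z
  darts⊆three (f , _ , _ , f-all) x-at y-at z-at x≢y x≢z y≢z d d-at
    with i , refl ← f-all _ x-at tt | j , refl ← f-all _ y-at tt
       | l , refl ← f-all _ z-at tt | h , refl ← f-all d d-at tt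
    = map (cong f) (map (cong f) (cong f))
        (cover₃ (x≢y ∘ cong f) (x≢z ∘ cong f) (y≢z ∘ cong f) h)

  rainbow⇒unique : (col : E → Fin 3) → ∀ {v} → Degree G 3 v →
    (∀ d d′ → vtx G d ≡ v → vtx G d′ ≡ v → d ≢ d′ → col (proj₁ d) ≢ col (proj₁ d′)) →
    ∀ k → UniqueDart (λ e → col e ≡ k) v
  rainbow⇒unique col {v} (f , f-inj , f-at , f-all) rainbow k =
    [ at-index zero , [ at-index (suc zero) , at-index (suc (suc zero)) ]′ ]′
      (cover₃ (distinct zero (suc zero) (λ ())) (distinct zero (suc (suc zero)) (λ ()))
              (distinct (suc zero) (suc (suc zero)) (λ ())) k)
    where
    colour : Fin 3 → Fin 3
    colour i = col (proj₁ (f i))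
    distinct : ∀ i j → i ≢ j → colour i ≢ colour j
    distinct i j i≢j = rainbow (f i) (f j) (proj₁ (f-at i)) (proj₁ (f-at j)) (i≢j ∘ f-inj)
    only : ∀ i → k ≡ colour i → ∀ d → vtx G d ≡ v → col (proj₁ d) ≡ k → d ≡ f i
    only i k≡ci d d-at d≡k with j , refl ← f-all d d-at tt with j ≟ i
    ... | yes refl = refl
    ... | no j≢i   = contradiction (trans d≡k k≡ci) (distinct j i j≢i)
    at-index : ∀ i → k ≡ colour i → UniqueDart (λ e → col e ≡ k) v
    at-index i k≡ci = f i , proj₁ (f-at i) , sym k≡ci , only i k≡ci

module _ (G : Graph) (A B : EdgeSet G) where
  open Graph G

  Free : V → Set
  Free v = ∀ d → vtx G d ≡ v → A (proj₁ d) ≡ false × B (proj₁ d) ≡ false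

  record OnCycle (v : V) : Set where
    field
      dartA dartB dartT : Dart G
      dartA-at : vtx G dartA ≡ v
      dartB-at : vtx G dartB ≡ v
      dartT-at : vtx G dartT ≡ v
      A∋dartA  : In G A (proj₁ dartA)
      B∋dartB  : In G B (proj₁ dartB)
      A∌dartT  : A (proj₁ dartT) ≡ false
      B∌dartT  : B (proj₁ dartT) ≡ false
      darts    : ∀ d → vtx G d ≡ v → d ≡ dartA ⊎ d ≡ dartB ⊎ d ≡ dartT

  degree0⇒Free : ∀ {v} → DegreeIn G (λ e → In G A e ⊎ In G B e) 0 v → Free v
  degree0⇒Free (_ , _ , _ , f-all) d d-at =
    ¬-not (λ d∈A → ¬Fin0 (proj₁ (f-all d d-at (inj₁ d∈A)))) ,
    ¬-not (λ d∈B → ¬Fin0 (proj₁ (f-all d d-at (inj₂ d∈B))))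

  degree2⇒darts-in-A-and-B : IsMatching G A → IsMatching G B →
    ∀ {v} → DegreeIn G (λ e → In G A e ⊎ In G B e) 2 v →
    ∃₂ λ x y → vtx G x ≡ v × In G A (proj₁ x) × vtx G y ≡ v × In G B (proj₁ y)
  degree2⇒darts-in-A-and-B A-matching B-matching (f , f-inj , f-at , _)
    with f-at zero | f-at (suc zero)
  ... | at₀ , inj₁ A∋₀ | at₁ , inj₁ A∋₁ =
    contradiction (f-inj (A-matching _ _ (trans at₀ (sym at₁)) A∋₀ A∋₁)) (λ ())
  ... | at₀ , inj₂ B∋₀ | at₁ , inj₂ B∋₁ =
    contradiction (f-inj (B-matching _ _ (trans at₀ (sym at₁)) B∋₀ B∋₁)) (λ ())
  ... | at₀ , inj₁ A∋₀ | at₁ , inj₂ B∋₁ = f zero , f (suc zero) , at₀ , A∋₀ , at₁ , B∋₁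
  ... | at₀ , inj₂ B∋₀ | at₁ , inj₁ A∋₁ = f (suc zero) , f zero , at₁ , A∋₁ , at₀ , B∋₀

  Disjoint⇒dart-≢ : Disjoint G A B → ∀ {x y : Dart G} → In G A (proj₁ x) → In G B (proj₁ y) → x ≢ y
  Disjoint⇒dart-≢ disjoint A∋x B∋y refl = disjoint _ (A∋x , B∋y)

  darts-in-A-and-B⇒OnCycle : IsMatching G A → IsMatching G B → Disjoint G A B →
    ∀ {v x y} → Degree G 3 v →
    vtx G x ≡ v → In G A (proj₁ x) → vtx G y ≡ v → In G B (proj₁ y) → OnCycle v
  darts-in-A-and-B⇒OnCycle A-matching B-matching disjoint {x = x} {y} deg x-at A∋x y-at B∋y
    with x≢y ← Disjoint⇒dart-≢ disjoint A∋x B∋y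
    with z , z-at , z≢x , z≢y ← third-dart G deg x-at y-at x≢y
    = record
      { dartA = x ; dartB = y ; dartT = z
      ; dartA-at = x-at ; dartB-at = y-at ; dartT-at = z-at
      ; A∋dartA = A∋x ; B∋dartB = B∋y
      ; A∌dartT = ¬-not (λ A∋z → z≢x (A-matching z x (trans z-at (sym x-at)) A∋z A∋x))
      ; B∌dartT = ¬-not (λ B∋z → z≢y (B-matching z y (trans z-at (sym y-at)) B∋z B∋y))
      ; darts = darts⊆three G deg x-at y-at z-at x≢y (z≢x ∘ sym) (z≢y ∘ sym)
      }

  Free⊎OnCycle : Cubic G → IsMatching G A → IsMatching G B → Disjoint G A B →
    UnionOfDisjointCycles G A B → ∀ v → Free v ⊎ OnCycle v
  Free⊎OnCycle cubic A-matching B-matching disjoint cycles v with cycles v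
  ... | inj₁ deg₀ = inj₁ (degree0⇒Free deg₀)
  ... | inj₂ deg₂ with x , y , x-at , A∋x , y-at , B∋y ← degree2⇒darts-in-A-and-B A-matching B-matching deg₂
    = inj₂ (darts-in-A-and-B⇒OnCycle A-matching B-matching disjoint (cubic v) x-at A∋x y-at B∋y)

  module _ {v : V} (C : OnCycle v) where
    open OnCycle C

    B∌dartA : Disjoint G A B → B (proj₁ dartA) ≡ false
    B∌dartA disjoint = ¬-not (λ B∋dartA → disjoint _ (A∋dartA , B∋dartA))

    A∌dartB : Disjoint G A B → A (proj₁ dartB) ≡ false
    A∌dartB disjoint = ¬-not (λ A∋dartB → disjoint _ (A∋dartB , B∋dartB))

    dartA≢dartT : dartA ≢ dartT
    dartA≢dartT A≡T = not-¬ A∋dartA (trans (cong (A ∘ proj₁) A≡T) A∌dartT)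

    darts∖B : ∀ d → vtx G d ≡ v → B (proj₁ d) ≡ false → d ≡ dartA ⊎ d ≡ dartT
    darts∖B d d-at B∌d with darts d d-at
    ... | inj₁ d≡A        = inj₁ d≡A
    ... | inj₂ (inj₁ refl) = contradiction B∌d (not-¬ B∋dartB)
    ... | inj₂ (inj₂ d≡T) = inj₂ d≡T

splitCopy : Bool → Bool → Fin 2 → Fin 2
splitCopy true  _     k = k
splitCopy false true  _ = suc zero
splitCopy false false _ = zero

splitCopy-false : ∀ a {b} → b ≡ false → splitCopy a b zero ≡ zero
splitCopy-false true  _    = refl
splitCopy-false false refl = refl

splitCopy≡zero : ∀ {a b k} → .(k ≡ zero ⊎ a ≡ true) → (a ≡ true → b ≡ false) →
  splitCopy a b k ≡ zero → k ≡ zero × b ≡ false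
splitCopy≡zero {true}                      _       a⇒¬b refl = refl , a⇒¬b refl
splitCopy≡zero {false} {true}              _       _    ()
splitCopy≡zero {false} {false} {zero}      _       _    _    = refl , refl
splitCopy≡zero {false} {false} {suc zero}  present _    _    = ⊥-elim-irr (absent present)
  where
  absent : ¬ (suc zero ≡ zero ⊎ false ≡ true)
  absent (inj₁ ())
  absent (inj₂ ())

module _ (G : Graph) (A B : EdgeSet G) where
  open Graph G

  private
    H : Graph
    H = Split G A B

  -- base v is v′ if v lies on a cycle of A ∪ B and v itself otherwise; it keeps
  -- every edge at v except the B-edge.
  base : V → SplitV G A B
  base v = sv v zero (inj₁ refl)

  lift : Dart G → Dart H
  lift (e , i) = se e zero (inj₁ refl) , i

  lift-injective : Injective _≡_ _≡_ lift
  lift-injective {_ , _} {_ , _} refl = refl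

  -- splitEnd matches on A e with an `in` equation, so its unfolding stores
  -- refl : A e ≡ A e.  Abstracting A e must leave the left-hand side of that
  -- equation alone; the dummy u : ⊤ makes A (x u) a copy of A (x tt) that is
  -- equal by η but invisible to with-abstraction.
  splitEnd-spec : ∀ e k .p i →
    SplitV.base (splitEnd G A B (se e k p) i) ≡ end e i
    × SplitV.copy (splitEnd G A B (se e k p) i) ≡ splitCopy (A e) (B e) k
  splitEnd-spec e k p i = go (λ _ → e) tt k p
    where
    go : (x : ⊤ → E) (u : ⊤) (k : Fin 2) .(p : k ≡ zero ⊎ A (x tt) ≡ true) →
      SplitV.base (splitEnd G A B (se (x tt) k p) i) ≡ end (x tt) i
      × SplitV.copy (splitEnd G A B (se (x tt) k p) i) ≡ splitCopy (A (x tt)) (B (x tt)) k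
    go x u k p with A (x tt) | (A (x u) ≡ A (x tt) ∋ refl)
    ... | true  | _ = refl , refl
    ... | false | _ with B (x tt) | (B (x u) ≡ B (x tt) ∋ refl)
    ...   | true  | _ = refl , refl
    ...   | false | _ = refl , refl

  private
    sv-≡ : ∀ {w w′ : SplitV G A B} → SplitV.base w ≡ SplitV.base w′ → SplitV.copy w ≡ SplitV.copy w′ → w ≡ w′
    sv-≡ {sv _ _ _} {sv _ _ _} refl refl = refl

  lift-at-base : ∀ {v} d → vtx G d ≡ v → B (proj₁ d) ≡ false → vtx H (lift d) ≡ base v
  lift-at-base (e , i) d-at B∌e with base-end , copy-end ← splitEnd-spec e zero (inj₁ refl) i =
    sv-≡ (trans base-end d-at) (trans copy-end (splitCopy-false (A e) B∌e))

  at-base⇒lift : Disjoint G A B → ∀ {v} D → vtx H D ≡ base v →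
    ∃ λ d → D ≡ lift d × vtx G d ≡ v × B (proj₁ d) ≡ false
  at-base⇒lift disjoint (se e k p , i) D-at
    with base-end , copy-end ← splitEnd-spec e k p i
    with refl , B∌e ← splitCopy≡zero p (λ A∋e → ¬-not (λ B∋e → disjoint e (A∋e , B∋e)))
                        (trans (sym copy-end) (cong SplitV.copy D-at))
    = (e , i) , refl , trans (sym base-end) (cong SplitV.base D-at) , B∌e

  DegreeIn⇒Degree-base : Disjoint G A B → ∀ {k v} →
    DegreeIn G (λ e → B e ≡ false) k v → Degree H k (base v)
  DegreeIn⇒Degree-base disjoint {v = v} (f , f-inj , f-at , f-all) =
    lift ∘ f , f-inj ∘ lift-injective , lift-f-at , lift-f-all
    where
    lift-f-at : ∀ i → vtx H (lift (f i)) ≡ base v × ⊤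
    lift-f-at i = lift-at-base (f i) (proj₁ (f-at i)) (proj₂ (f-at i)) , tt
    lift-f-all : ∀ D → vtx H D ≡ base v → ⊤ → ∃ λ i → lift (f i) ≡ D
    lift-f-all D D-at _ with d , refl , d-at , B∌d ← at-base⇒lift disjoint D D-at
      with i , refl ← f-all d d-at B∌d = i , refl

chooses : Bool → Bool → Fin 3 → Fin 3 → Bool
chooses true  _     c k = not (does (c ≟ k))
chooses false true  _ _ = false
chooses false false c k = does (c ≟ k)

chooses-inA : ∀ {a} b c k → a ≡ true → chooses a b c k ≡ true ⇔ c ≢ k
chooses-inA _ c k refl = not-does≡true⇔ (c ≟ k)

chooses-inB : ∀ {a b} c k → a ≡ false → b ≡ true → chooses a b c k ≢ true
chooses-inB _ _ refl refl ()

chooses-free : ∀ {a b} c k → a ≡ false → b ≡ false → chooses a b c k ≡ true ⇔ c ≡ k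
chooses-free c k refl refl = does≡true⇔ (c ≟ k)

weight : Bool → Bool → ℕ
weight true  _     = 2
weight false true  = 0
weight false false = 1

weight≢3 : ∀ a b → weight a b ≢ 3
weight≢3 true  _     ()
weight≢3 false true  ()
weight≢3 false false ()

weight≡2⇒ : ∀ a b → weight a b ≡ 2 → a ≡ true
weight≡2⇒ true  _     _  = refl
weight≡2⇒ false true  ()
weight≡2⇒ false false ()

weight≡0⇒ : ∀ a b → weight a b ≡ 0 → b ≡ true
weight≡0⇒ true  _     ()
weight≡0⇒ false true  _  = refl
weight≡0⇒ false false ()

weight-inA : ∀ {a} b → a ≡ true → weight a b ≡ 2
weight-inA _ refl = refl

weight-inB : ∀ {a b} → a ≡ false → b ≡ true → weight a b ≡ 0
weight-inB refl refl = refl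

module FRTriple (G : Graph) (A B : EdgeSet G)
  (cubic : Cubic G) (A-matching : IsMatching G A) (B-matching : IsMatching G B)
  (disjoint : Disjoint G A B) (cycles : UnionOfDisjointCycles G A B)
  (colouring : SuppressedColourable3 (Split G A B)) where
  open Graph G

  col : E → Fin 3
  col e = proj₁ colouring (proj₁ (lift G A B (e , zero)))

  M : Fin 3 → EdgeSet G
  M k e = chooses (A e) (B e) (col e) k

  Free⇒rainbow : ∀ {v} → Free G A B v → ∀ d d′ → vtx G d ≡ v → vtx G d′ ≡ v → d ≢ d′ →
    col (proj₁ d) ≢ col (proj₁ d′)
  Free⇒rainbow {v} free d d′ d-at d′-at d≢d′ =
    proj₂ (proj₂ colouring (base G A B v) (lift G A B d) (lift G A B d′)
             (lift-at-base G A B d d-at (proj₂ (free d d-at)))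
             (lift-at-base G A B d′ d′-at (proj₂ (free d′ d′-at)))
             (d≢d′ ∘ lift-injective G A B))
      (DegreeIn⇒Degree-base G A B disjoint (Degree⇒DegreeIn G (λ d d-at → proj₂ (free d d-at)) (cubic v)))

  Free⇒unique : ∀ {v} → Free G A B v → ∀ k → UniqueDart G (In G (M k)) v
  Free⇒unique {v} free k =
    UniqueDart-resp G
      (λ d d-at → let A∌d , B∌d = free d d-at in ⇔-sym (chooses-free (col (proj₁ d)) k A∌d B∌d))
      (rainbow⇒unique G col (cubic v) (Free⇒rainbow free) k)

  module _ {v : V} (C : OnCycle G A B v) where
    open OnCycle C

    OnCycle⇒same-colour : col (proj₁ dartA) ≡ col (proj₁ dartT)
    OnCycle⇒same-colour =
      proj₁ (proj₂ colouring (base G A B v) (lift G A B dartA) (lift G A B dartT)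
               (lift-at-base G A B dartA dartA-at (B∌dartA G A B C disjoint))
               (lift-at-base G A B dartT dartT-at B∌dartT)
               (dartA≢dartT G A B C ∘ lift-injective G A B))
        (DegreeIn⇒Degree-base G A B disjoint
          (pair⇒DegreeIn₂ G (dartA≢dartT G A B C) dartA-at dartT-at
            (B∌dartA G A B C disjoint) B∌dartT (darts∖B G A B C)))

    OnCycle⇒M-darts : ∀ k d → vtx G d ≡ v → In G (M k) (proj₁ d) →
      (d ≡ dartA × col (proj₁ dartA) ≢ k) ⊎ (d ≡ dartT × col (proj₁ dartT) ≡ k)
    OnCycle⇒M-darts k d d-at d∈M with darts d d-at
    ... | inj₁ refl        = inj₁ (refl , Equivalence.to (chooses-inA _ _ k A∋dartA) d∈M)
    ... | inj₂ (inj₁ refl) = contradiction d∈M (chooses-inB _ k (A∌dartB G A B C disjoint) B∋dartB)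
    ... | inj₂ (inj₂ refl) = inj₂ (refl , Equivalence.to (chooses-free _ k A∌dartT B∌dartT) d∈M)

    OnCycle⇒unique : ∀ k → UniqueDart G (In G (M k)) v
    OnCycle⇒unique k with col (proj₁ dartA) ≟ k
    ... | yes A≡k =
      dartT , dartT-at ,
      Equivalence.from (chooses-free _ k A∌dartT B∌dartT) (trans (sym OnCycle⇒same-colour) A≡k) ,
      λ d d-at d∈M → [ contradiction A≡k ∘ proj₂ , proj₁ ]′ (OnCycle⇒M-darts k d d-at d∈M)
    ... | no A≢k =
      dartA , dartA-at , Equivalence.from (chooses-inA _ _ k A∋dartA) A≢k ,
      λ d d-at d∈M → [ proj₁ , (λ T≡k → contradiction (trans OnCycle⇒same-colour T≡k) A≢k) ∘ proj₂ ]′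
                       (OnCycle⇒M-darts k d d-at d∈M)

  M-perfect : ∀ k → IsPerfectMatching G (M k)
  M-perfect k = unique⇒perfectMatching G λ v →
    [ (λ free → Free⇒unique free k) , (λ C → OnCycle⇒unique C k) ]′
      (Free⊎OnCycle G A B cubic A-matching B-matching disjoint cycles v)

  mult-M : ∀ e → mult G (M zero) (M (suc zero)) (M (suc (suc zero))) e ≡ weight (A e) (B e)
  mult-M e = count (A e) (B e) (col e)
    where
    count : ∀ a b c →
      b2n G (chooses a b c zero) + b2n G (chooses a b c (suc zero)) + b2n G (chooses a b c (suc (suc zero)))
      ≡ weight a b
    count true  _     zero             = refl
    count true  _     (suc zero)       = refl
    count true  _     (suc (suc zero)) = refl
    count false true  _                = refl
    count false false zero             = refl
    count false false (suc zero)       = refl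
    count false false (suc (suc zero)) = refl

  M-no-common-edge : ∀ e → ¬ (In G (M zero) e × In G (M (suc zero)) e × In G (M (suc (suc zero))) e)
  M-no-common-edge e (m₀ , m₁ , m₂) = weight≢3 (A e) (B e) (trans (sym (mult-M e)) in-all-three)
    where
    in-all-three : b2n G (M zero e) + b2n G (M (suc zero) e) + b2n G (M (suc (suc zero)) e) ≡ 3
    in-all-three rewrite m₀ | m₁ | m₂ = refl

  T₂≡A : SameSet G (Tset G (M zero) (M (suc zero)) (M (suc (suc zero))) 2) A
  T₂≡A e = weight≡2⇒ (A e) (B e) ∘ trans (sym (mult-M e)) ,
           λ A∋e → trans (mult-M e) (weight-inA (B e) A∋e)

  T₀≡B : SameSet G (Tset G (M zero) (M (suc zero)) (M (suc (suc zero))) 0) B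
  T₀≡B e = weight≡0⇒ (A e) (B e) ∘ trans (sym (mult-M e)) ,
           λ B∋e → trans (mult-M e) (weight-inB (¬-not (λ A∋e → disjoint e (A∋e , B∋e))) B∋e)

lemma2p3 : (n m : ℕ) (end : Fin m → Fin 2 → Fin n) (A₁ A₂ : Fin m → Bool) →
    Cubic (FinGraph n m end) →
    Bridgeless (FinGraph n m end) →
    IsMatching (FinGraph n m end) A₁ →
    IsMatching (FinGraph n m end) A₂ →
    Disjoint (FinGraph n m end) A₁ A₂ →
    UnionOfDisjointCycles (FinGraph n m end) A₁ A₂ →
    SuppressedColourable3 (Split (FinGraph n m end) A₁ A₂) →
    ∃ λ M₁ → ∃ λ M₂ → ∃ λ M₃ →
      IsFRTriple (FinGraph n m end) M₁ M₂ M₃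
      × SameSet (FinGraph n m end) (Tset (FinGraph n m end) M₁ M₂ M₃ 2) A₁
      × SameSet (FinGraph n m end) (Tset (FinGraph n m end) M₁ M₂ M₃ 0) A₂
lemma2p3 n m end A₁ A₂ cubic _ A₁-matching A₂-matching disjoint cycles colouring =
  M zero , M (suc zero) , M (suc (suc zero)) ,
  (M-perfect zero , M-perfect (suc zero) , M-perfect (suc (suc zero)) , M-no-common-edge) ,
  T₂≡A , T₀≡B
  where
  open FRTriple (FinGraph n m end) A₁ A₂ cubic A₁-matching A₂-matching disjoint cycles colouring
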